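{- For integers $N\ge i\ge 0$, let $L^{\mathbf{ud}}_{N,i}$ be the number of G-Motzkin paths of length $N$ with exactly $i$ $\mathbf{ud}$-peaks. Then for all integers $n,m\ge 0$, \[ \sum_{i=0}^{2n}(-1)^{i}\binom{2n}{i}L^{\mathbf{ud}}_{n+2m+2i,\,m+i}=C_n, \] where $C_n=\frac{1}{n+1}\binom{2n}{n}$ is the $n$-th Catalan number.
   Context: A G-Motzkin path of length $N$ is a lattice path from $(0,0)$ to $(N,0)$ that never goes below the $x$-axis and consists of up steps $\mathbf{u}=(1,1)$, down steps $\mathbf{d}=(1,-1)$, horizontal steps $\mathbf{h}=(1,0)$ and vertical steps $\mathbf{v}=(0,-1)$; it is encoded as the word of its steps. A $\mathbf{ud}$-peak is an occurrence of a $\mathbf{u}$-step immediately followed by a $\mathbf{d}$-step. -}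

module Defs where

open import Data.Nat using (ℕ; zero; suc; _+_; _*_; _≤_; _/_)
open import Data.Nat.Combinatorics using (_C_)
open import Data.Integer using (ℤ; +_; -_)
open import Data.List using (List; []; _∷_; length; filter; concatMap; map; upTo)
open import Data.Product using (_×_; _,_)
open import Relation.Nullary using (Dec; yes; no)
open import Relation.Nullary.Decidable using (_×-dec_)
open import Relation.Binary.PropositionalEquality using (_≡_)
open import Data.Maybe using (Maybe; just; nothing)
import Data.Nat as ℕ
import Data.Maybe as M
import Data.Maybe.Properties as MP

-- Steps of a G-Motzkin path: u = (1,1), d = (1,-1), h = (1,0), v = (0,-1)
data Step : Set where
  u d h v : Step

xlen : List Step → ℕ
xlen [] = 0
xlen (v ∷ w) = xlen w
xlen (_ ∷ w) = suc (xlen w)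

walk : ℕ → List Step → Maybe ℕ
walk k [] = just k
walk k (u ∷ w) = walk (suc k) w
walk k (h ∷ w) = walk k w
walk zero (d ∷ w) = nothing
walk (suc k) (d ∷ w) = walk k w
walk zero (v ∷ w) = nothing
walk (suc k) (v ∷ w) = walk k w

IsGMotzkin : ℕ → List Step → Set
IsGMotzkin N w = (xlen w ≡ N) × (walk 0 w ≡ just 0)

udPeaks : List Step → ℕ
udPeaks [] = 0
udPeaks (u ∷ d ∷ w) = suc (udPeaks (d ∷ w))
udPeaks (_ ∷ w) = udPeaks w

words : ℕ → List (List Step)
words zero = [] ∷ []
words (suc k) = concatMap (λ w → (u ∷ w) ∷ (d ∷ w) ∷ (h ∷ w) ∷ (v ∷ w) ∷ []) (words k)

wordsUpTo : ℕ → List (List Step)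
wordsUpTo zero = words zero
wordsUpTo (suc k) = Data.List._++_ (wordsUpTo k) (words (suc k))

_≟M_ : (a b : Maybe ℕ) → Dec (a ≡ b)
_≟M_ = MP.≡-dec ℕ._≟_

-- A G-Motzkin path of length N has at most N up steps, hence at most N
-- down/vertical steps, so its word length is at most 2N; the list below
-- therefore contains every G-Motzkin path of length N exactly once.
L-ud : ℕ → ℕ → ℕ
L-ud N i = length (filter (λ w → ((xlen w ℕ.≟ N) ×-dec (walk 0 w ≟M just 0)) ×-dec (udPeaks w ℕ.≟ i))
                          (wordsUpTo (2 * N)))

catalan : ℕ → ℕ
catalan n = ((2 * n) C n) / suc n

sign : ℕ → ℤ
sign zero = + 1
sign (suc i) = - sign i

sumTo : ℕ → (ℕ → ℤ) → ℤ
sumTo zero f = f 0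
sumTo (suc k) f = Data.Integer._+_ (sumTo k f) (f (suc k))

-- Fix the number m of ud-peaks and let ℓ and n be the word length and the x-length left
-- after discounting the 2m letters of the peaks. Deleting the first peak expresses the
-- difference in m of the number of such paths through the counts for ℓ − 1; so, by
-- induction on ℓ, this number is a polynomial in m of degree at most ℓ whose ℓ-th
-- difference counts the walks of length ℓ and x-length n with peaks ignored. The
-- alternating sum is the 2n-th difference in m of L_{n+2m,m}, which is the sum of these
-- polynomials over ℓ ≤ 2n; only ℓ = 2n survives, and the walks of length 2n and x-length n
-- use only u and v steps: they are Dyck paths, counted by the ballot numbers as C_n.

module Submission where

module FiniteDifferences where

  open import Defs using (sign; sumTo)
  open import Data.Nat as ℕ using (ℕ; zero; suc; _<_; s≤s)
  import Data.Nat.Properties as ℕ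
  open import Data.Nat.Combinatorics using (_C_; k>n⇒nCk≡0; nCk+nC[k+1]≡[n+1]C[k+1])
  open import Data.Integer using (ℤ; +_; -_; _+_; _-_; _*_)
  open import Data.Integer.Properties using (pos-+; neg-involutive; neg-distribˡ-*; *-identityˡ; *-zeroʳ; +-identityˡ; +-identityʳ)
  open import Data.Integer.Solver using (module +-*-Solver)
  open +-*-Solver using (solve; _:=_; _:+_; _:*_; _:-_; :-_; con)
  open import Relation.Binary.PropositionalEquality

  -- δ j = (−Δ)^j for the forward difference Δ; see δ≡alternatingSum.
  δ : ℕ → (ℕ → ℤ) → ℕ → ℤ
  δ zero f m = f m
  δ (suc j) f m = δ j f m - δ j f (suc m)

  Δ : (ℕ → ℤ) → ℕ → ℤ
  Δ f m = f (suc m) - f m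

  δ-cong : ∀ j {f g : ℕ → ℤ} → (∀ x → f x ≡ g x) → ∀ m → δ j f m ≡ δ j g m
  δ-cong zero f≡g m = f≡g m
  δ-cong (suc j) f≡g m = cong₂ _-_ (δ-cong j f≡g m) (δ-cong j f≡g (suc m))

  δ-+ : ∀ j (f g : ℕ → ℤ) m → δ j (λ x → f x + g x) m ≡ δ j f m + δ j g m
  δ-+ zero f g m = refl
  δ-+ (suc j) f g m rewrite δ-+ j f g m | δ-+ j f g (suc m) =
    solve 4 (λ a b c e → a :+ b :- (c :+ e) := a :- c :+ (b :- e)) refl
      (δ j f m) (δ j g m) (δ j f (suc m)) (δ j g (suc m))

  δ-neg : ∀ j (f : ℕ → ℤ) m → δ j (λ x → - f x) m ≡ - δ j f m
  δ-neg zero f m = refl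
  δ-neg (suc j) f m rewrite δ-neg j f m | δ-neg j f (suc m) =
    solve 2 (λ a c → :- a :- :- c := :- (a :- c)) refl (δ j f m) (δ j f (suc m))

  δ-shift : ∀ j (f : ℕ → ℤ) m → δ j (λ x → f (suc x)) m ≡ δ j f (suc m)
  δ-shift zero f m = refl
  δ-shift (suc j) f m rewrite δ-shift j f m | δ-shift j f (suc m) = refl

  δ-zero : ∀ j m → δ j (λ _ → + 0) m ≡ + 0
  δ-zero zero m = refl
  δ-zero (suc j) m rewrite δ-zero j m | δ-zero j (suc m) = refl

  δ-const : ∀ j c m → δ (suc j) (λ _ → c) m ≡ + 0
  δ-const zero c m = solve 1 (λ c → c :- c := con (+ 0)) refl c
  δ-const (suc j) c m rewrite δ-const j c m | δ-const j c (suc m) = refl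

  δ-suc : ∀ j (f : ℕ → ℤ) m → δ (suc j) f m ≡ - δ j (Δ f) m
  δ-suc j f m = begin
    δ j f m - δ j f (suc m)                          ≡⟨ solve 2 (λ a c → a :- c := :- (c :+ :- a)) refl (δ j f m) _ ⟩
    - (δ j f (suc m) + - δ j f m)                    ≡⟨ cong -_ (cong₂ _+_ (δ-shift j f m) (δ-neg j f m)) ⟨
    - (δ j (λ x → f (suc x)) m + δ j (λ x → - f x) m) ≡⟨ cong -_ (δ-+ j _ _ m) ⟨
    - δ j (Δ f) m                                      ∎
    where open ≡-Reasoning

  sumTo-cong : ∀ k {f g : ℕ → ℤ} → (∀ x → f x ≡ g x) → sumTo k f ≡ sumTo k g
  sumTo-cong zero f≡g = f≡g 0
  sumTo-cong (suc k) f≡g = cong₂ _+_ (sumTo-cong k f≡g) (f≡g (suc k))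

  sumTo-+ : ∀ k (f g : ℕ → ℤ) → sumTo k (λ x → f x + g x) ≡ sumTo k f + sumTo k g
  sumTo-+ zero f g = refl
  sumTo-+ (suc k) f g rewrite sumTo-+ k f g =
    solve 4 (λ a b c e → a :+ b :+ (c :+ e) := a :+ c :+ (b :+ e)) refl
      (sumTo k f) (sumTo k g) (f (suc k)) (g (suc k))

  sumTo-neg : ∀ k (f : ℕ → ℤ) → sumTo k (λ x → - f x) ≡ - sumTo k f
  sumTo-neg zero f = refl
  sumTo-neg (suc k) f rewrite sumTo-neg k f =
    solve 2 (λ a b → :- a :+ :- b := :- (a :+ b)) refl (sumTo k f) (f (suc k))

  sumTo-suc : ∀ k (f : ℕ → ℤ) → sumTo (suc k) f ≡ f 0 + sumTo k (λ x → f (suc x))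
  sumTo-suc zero f = refl
  sumTo-suc (suc k) f rewrite sumTo-suc k f =
    solve 3 (λ a b c → a :+ b :+ c := a :+ (b :+ c)) refl (f 0) (sumTo k (λ x → f (suc x))) (f (suc (suc k)))

  alternatingSum : ℕ → (ℕ → ℤ) → ℕ → ℤ
  alternatingSum j f m = sumTo j (λ i → sign i * (+ (j C i) * f (m ℕ.+ i)))

  δ≡alternatingSum : ∀ j f m → δ j f m ≡ alternatingSum j f m
  δ≡alternatingSum zero f m =
    trans (solve 1 (λ x → x := con (+ 1) :* (con (+ 1) :* x)) refl (f m))
          (cong (λ k → + 1 * (+ 1 * f k)) (sym (ℕ.+-identityʳ m)))
  δ≡alternatingSum (suc j) f m = sym (begin
      sumTo (suc j) (term (suc j) m)
    ≡⟨ sumTo-suc j _ ⟩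
      term (suc j) m 0 + sumTo j (λ i → term (suc j) m (suc i))
    ≡⟨ cong (λ s → term j m 0 + s) (trans (sumTo-cong j pascal) (sumTo-+ j _ _)) ⟩
      term j m 0 + (sumTo j (λ i → - term j (suc m) i) + sumTo j (λ i → term j m (suc i)))
    ≡⟨ cong (λ s → term j m 0 + (s + sumTo j (λ i → term j m (suc i)))) (sumTo-neg j _) ⟩
      term j m 0 + (- sumTo j (term j (suc m)) + sumTo j (λ i → term j m (suc i)))
    ≡⟨ solve 3 (λ a b c → a :+ (:- b :+ c) := a :+ c :- b) refl (term j m 0) (sumTo j (term j (suc m))) _ ⟩
      term j m 0 + sumTo j (λ i → term j m (suc i)) - sumTo j (term j (suc m))
    ≡⟨ cong (_- sumTo j (term j (suc m))) (sumTo-suc j (term j m)) ⟨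
      sumTo j (term j m) + term j m (suc j) - sumTo j (term j (suc m))
    ≡⟨ cong (λ s → sumTo j (term j m) + s - sumTo j (term j (suc m))) last-vanishes ⟩
      sumTo j (term j m) + + 0 - sumTo j (term j (suc m))
    ≡⟨ cong₂ (λ a b → a + + 0 - b) (δ≡alternatingSum j f m) (δ≡alternatingSum j f (suc m)) ⟨
      δ j f m + + 0 - δ j f (suc m)
    ≡⟨ cong (_- δ j f (suc m)) (+-identityʳ (δ j f m)) ⟩
      δ j f m - δ j f (suc m) ∎)
    where
    open ≡-Reasoning
    term : ℕ → ℕ → ℕ → ℤ
    term j m i = sign i * (+ (j C i) * f (m ℕ.+ i))
    pascal : ∀ i → term (suc j) m (suc i) ≡ - term j (suc m) i + term j m (suc i)
    pascal i rewrite sym (nCk+nC[k+1]≡[n+1]C[k+1] j i) | pos-+ (j C i) (j C suc i) | ℕ.+-suc m i =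
      solve 4 (λ s a b x → :- s :* ((a :+ b) :* x) := :- (s :* (a :* x)) :+ :- s :* (b :* x)) refl
        (sign i) (+ (j C i)) (+ (j C suc i)) (f (suc m ℕ.+ i))
    last-vanishes : term j m (suc j) ≡ + 0
    last-vanishes rewrite k>n⇒nCk≡0 {j} {suc j} (ℕ.n<1+n j) = *-zeroʳ (sign (suc j))

  -- f is a polynomial of degree ≤ ℓ whose ℓ-th forward difference is constantly c.
  record Polynomial (ℓ : ℕ) (f : ℕ → ℤ) (c : ℕ) : Set where
    field
      δ-above : ∀ {j} → ℓ < j → ∀ m → δ j f m ≡ + 0
      δ-top : ∀ m → δ ℓ f m ≡ sign ℓ * + c

  open Polynomial

  poly-cong : ∀ {ℓ f g c c′} → (∀ x → f x ≡ g x) → c ≡ c′ → Polynomial ℓ f c → Polynomial ℓ g c′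
  poly-cong {ℓ} f≡g refl p = record
    { δ-above = λ {j} ℓ<j m → trans (sym (δ-cong j f≡g m)) (δ-above p ℓ<j m)
    ; δ-top = λ m → trans (sym (δ-cong ℓ f≡g m)) (δ-top p m)
    }

  poly-zero : ∀ ℓ → Polynomial ℓ (λ _ → + 0) 0
  poly-zero ℓ = record
    { δ-above = λ {j} _ m → δ-zero j m
    ; δ-top = λ m → trans (δ-zero ℓ m) (sym (*-zeroʳ (sign ℓ)))
    }

  poly-const : ∀ c → Polynomial 0 (λ _ → + c) c
  poly-const c = record
    { δ-above = λ { {suc j} _ m → δ-const j (+ c) m }
    ; δ-top = λ m → sym (*-identityˡ (+ c))
    }

  poly-shift : ∀ {ℓ f c} → Polynomial ℓ f c → Polynomial ℓ (λ x → f (suc x)) c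
  poly-shift {ℓ} {f} p = record
    { δ-above = λ {j} ℓ<j m → trans (δ-shift j f m) (δ-above p ℓ<j (suc m))
    ; δ-top = λ m → trans (δ-shift ℓ f m) (δ-top p (suc m))
    }

  poly-+ : ∀ {ℓ f g a b} → Polynomial ℓ f a → Polynomial ℓ g b → Polynomial ℓ (λ x → f x + g x) (a ℕ.+ b)
  poly-+ {ℓ} {f} {g} {a} {b} p q = record
    { δ-above = λ {j} ℓ<j m → trans (δ-+ j f g m) (cong₂ _+_ (δ-above p ℓ<j m) (δ-above q ℓ<j m))
    ; δ-top = λ m → begin
        δ ℓ (λ x → f x + g x) m       ≡⟨ δ-+ ℓ f g m ⟩
        δ ℓ f m + δ ℓ g m             ≡⟨ cong₂ _+_ (δ-top p m) (δ-top q m) ⟩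
        sign ℓ * + a + sign ℓ * + b   ≡⟨ solve 3 (λ s x y → s :* x :+ s :* y := s :* (x :+ y)) refl (sign ℓ) (+ a) (+ b) ⟩
        sign ℓ * (+ a + + b)          ≡⟨ cong (sign ℓ *_) (pos-+ a b) ⟨
        sign ℓ * + (a ℕ.+ b)          ∎
    }
    where open ≡-Reasoning

  poly-Δ : ∀ {ℓ f c} → Polynomial ℓ (Δ f) c → Polynomial (suc ℓ) f c
  poly-Δ {ℓ} {f} {c} p = record
    { δ-above = λ { {suc j} (s≤s ℓ<j) m → trans (δ-suc j f m) (cong -_ (δ-above p ℓ<j m)) }
    ; δ-top = λ m → trans (δ-suc ℓ f m) (trans (cong -_ (δ-top p m)) (neg-distribˡ-* (sign ℓ) (+ c)))
    }

  poly-raise : ∀ {ℓ f c} → Polynomial ℓ f c → Polynomial (suc ℓ) f 0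
  poly-raise {ℓ} p = record
    { δ-above = λ ℓ<j → δ-above p (ℕ.<-trans (ℕ.n<1+n ℓ) ℓ<j)
    ; δ-top = λ m → trans (δ-above p (ℕ.n<1+n ℓ) m) (sym (*-zeroʳ (sign (suc ℓ))))
    }

  δ-sumTo : ∀ j k (F : ℕ → ℕ → ℤ) m → δ j (λ x → sumTo k (λ ℓ → F ℓ x)) m ≡ sumTo k (λ ℓ → δ j (F ℓ) m)
  δ-sumTo j zero F m = refl
  δ-sumTo j (suc k) F m = trans (δ-+ j _ (F (suc k)) m) (cong (_+ δ j (F (suc k)) m) (δ-sumTo j k F m))

  sumTo-vanishes : ∀ k (g : ℕ → ℤ) → (∀ ℓ → ℓ ℕ.≤ k → g ℓ ≡ + 0) → sumTo k g ≡ + 0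
  sumTo-vanishes zero g g≡0 = g≡0 0 ℕ.z≤n
  sumTo-vanishes (suc k) g g≡0 =
    cong₂ _+_ (sumTo-vanishes k g (λ ℓ ℓ≤k → g≡0 ℓ (ℕ.m≤n⇒m≤1+n ℓ≤k))) (g≡0 (suc k) ℕ.≤-refl)

  δ-top-sumTo : ∀ k {F : ℕ → ℕ → ℤ} {c : ℕ → ℕ} → (∀ ℓ → Polynomial ℓ (F ℓ) (c ℓ)) →
                ∀ m → δ k (λ x → sumTo k (λ ℓ → F ℓ x)) m ≡ sign k * + c k
  δ-top-sumTo zero P m = δ-top (P 0) m
  δ-top-sumTo (suc k) {F} P m = begin
    δ (suc k) (λ x → sumTo (suc k) (λ ℓ → F ℓ x)) m                     ≡⟨ δ-sumTo (suc k) (suc k) F m ⟩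
    sumTo k (λ ℓ → δ (suc k) (F ℓ) m) + δ (suc k) (F (suc k)) m     ≡⟨ cong₂ _+_ lower-vanish (δ-top (P (suc k)) m) ⟩
    + 0 + sign (suc k) * + _                                             ≡⟨ +-identityˡ _ ⟩
    sign (suc k) * + _                                                   ∎
    where
    open ≡-Reasoning
    lower-vanish : sumTo k (λ ℓ → δ (suc k) (F ℓ) m) ≡ + 0
    lower-vanish = sumTo-vanishes k _ (λ ℓ ℓ≤k → δ-above (P ℓ) (s≤s ℓ≤k) m)

  sign-even : ∀ n → sign (2 ℕ.* n) ≡ + 1
  sign-even zero = refl
  sign-even (suc n) rewrite ℕ.+-suc n (n ℕ.+ 0) = trans (neg-involutive (sign (2 ℕ.* n))) (sign-even n)

module Paths where

  open import Defs renaming (h to hor)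
  open import Data.Nat using (ℕ; zero; suc; _+_; _*_; _<_; s≤s)
  open import Data.Nat.Properties
  open import Data.Bool using (Bool; true; false; _∧_)
  open import Data.Bool.Properties using (∧-zeroʳ)
  open import Data.List using (List; []; _∷_; length; filter; concatMap; _++_)
  open import Data.Maybe using (just)
  open import Relation.Nullary using (does)
  open import Relation.Unary using (Decidable)
  open import Relation.Binary.PropositionalEquality
  open import Data.Nat.Solver using (module +-*-Solver)
  open +-*-Solver

  bit : Bool → ℕ
  bit false = 0
  bit true = 1

  count : ∀ {A : Set} → (A → Bool) → List A → ℕ
  count P [] = 0
  count P (x ∷ xs) = bit (P x) + count P xs

  count-++ : ∀ {A : Set} (P : A → Bool) xs ys → count P (xs ++ ys) ≡ count P xs + count P ys
  count-++ P [] ys = refl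
  count-++ P (x ∷ xs) ys = trans (cong (bit (P x) +_) (count-++ P xs ys)) (sym (+-assoc (bit (P x)) _ _))

  count-none : ∀ {A : Set} (P : A → Bool) → (∀ x → P x ≡ false) → ∀ xs → count P xs ≡ 0
  count-none P none [] = refl
  count-none P none (x ∷ xs) rewrite none x = count-none P none xs

  length-filter≡count : ∀ {A : Set} {P : A → Set} (P? : Decidable P) xs →
                        length (filter P? xs) ≡ count (λ x → does (P? x)) xs
  length-filter≡count P? [] = refl
  length-filter≡count P? (x ∷ xs) with does (P? x)
  ... | true = cong suc (length-filter≡count P? xs)
  ... | false = length-filter≡count P? xs

  count-words-suc : ∀ (P : List Step → Bool) L → count P (words (suc L)) ≡
    count (λ w → P (u ∷ w)) (words L) + count (λ w → P (hor ∷ w)) (words L) +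
    count (λ w → P (v ∷ w)) (words L) + count (λ w → P (d ∷ w)) (words L)
  count-words-suc P L = go (words L)
    where
    go : ∀ ws → count P (concatMap (λ w → (u ∷ w) ∷ (d ∷ w) ∷ (hor ∷ w) ∷ (v ∷ w) ∷ []) ws) ≡
      count (λ w → P (u ∷ w)) ws + count (λ w → P (hor ∷ w)) ws + count (λ w → P (v ∷ w)) ws + count (λ w → P (d ∷ w)) ws
    go [] = refl
    go (w ∷ ws) rewrite go ws =
      solve 8 (λ a b c e x y z t → a :+ (b :+ (c :+ (e :+ (x :+ z :+ t :+ y))))
                                 := a :+ x :+ (c :+ z) :+ (e :+ t) :+ (b :+ y)) refl
        (bit (P (u ∷ w))) (bit (P (d ∷ w))) (bit (P (hor ∷ w))) (bit (P (v ∷ w)))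
        (count (λ w → P (u ∷ w)) ws) (count (λ w → P (d ∷ w)) ws) (count (λ w → P (hor ∷ w)) ws) (count (λ w → P (v ∷ w)) ws)

  -- The flag b records that the preceding step was u, so that a leading d closes a peak.
  peaksAfter : Bool → List Step → ℕ
  peaksAfter false w = udPeaks w
  peaksAfter true w = udPeaks (u ∷ w)

  accepts : ℕ → Bool → ℕ → ℕ → List Step → Bool
  accepts y b N k w = (does (xlen w ≟ N) ∧ does (walk y w ≟M just 0)) ∧ does (peaksAfter b w ≟ k)

  emptyCount : ℕ → ℕ → ℕ → ℕ
  emptyCount zero zero zero = 1
  emptyCount _ _ _ = 0

  mutual
    paths : ℕ → ℕ → Bool → ℕ → ℕ → ℕ
    paths zero y b N k = emptyCount y N k
    paths (suc L) y b N k = pathsNoD (suc L) y b N k + pathsAfter d L y b N k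

    pathsNoD : ℕ → ℕ → Bool → ℕ → ℕ → ℕ
    pathsNoD zero y b N k = emptyCount y N k
    pathsNoD (suc L) y b N k = pathsAfter u L y b N k + pathsAfter hor L y b N k + pathsAfter v L y b N k

    pathsAfter : Step → ℕ → ℕ → Bool → ℕ → ℕ → ℕ
    pathsAfter u L y b zero k = 0
    pathsAfter u L y b (suc N) k = paths L (suc y) true N k
    pathsAfter hor L y b zero k = 0
    pathsAfter hor L y b (suc N) k = paths L y false N k
    pathsAfter v L zero b N k = 0
    pathsAfter v L (suc y) b N k = paths L y false N k
    pathsAfter d L zero b N k = 0
    pathsAfter d L (suc y) b zero k = 0
    pathsAfter d L (suc y) false (suc N) k = paths L y false N k
    pathsAfter d L (suc y) true (suc N) zero = 0
    pathsAfter d L (suc y) true (suc N) (suc k) = paths L y false N k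

  accepts-[] : ∀ y b N k → bit (accepts y b N k []) ≡ emptyCount y N k
  accepts-[] zero false zero zero = refl
  accepts-[] zero true zero zero = refl
  accepts-[] zero false zero (suc k) = refl
  accepts-[] zero true zero (suc k) = refl
  accepts-[] zero b (suc N) k = refl
  accepts-[] (suc y) b zero k = refl
  accepts-[] (suc y) b (suc N) k = refl

  mutual
    count-words : ∀ L y b N k → count (accepts y b N k) (words L) ≡ paths L y b N k
    count-words zero y b N k = trans (+-identityʳ _) (accepts-[] y b N k)
    count-words (suc L) y b N k = begin
        count (accepts y b N k) (words (suc L))
      ≡⟨ count-words-suc (accepts y b N k) L ⟩
        count (after u) (words L) + count (after hor) (words L) + count (after v) (words L) + count (after d) (words L)
      ≡⟨ cong₂ _+_ (cong₂ _+_ (cong₂ _+_ (count-after u L y b N k) (count-after hor L y b N k))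
                             (count-after v L y b N k)) (count-after d L y b N k) ⟩
        paths (suc L) y b N k ∎
      where
      open ≡-Reasoning
      after : Step → List Step → Bool
      after s w = accepts y b N k (s ∷ w)

    count-after : ∀ s L y b N k → count (λ w → accepts y b N k (s ∷ w)) (words L) ≡ pathsAfter s L y b N k
    count-after u L y b zero k = count-none _ (λ _ → refl) (words L)
    count-after u L y false (suc N) k = count-words L (suc y) true N k
    count-after u L y true (suc N) k = count-words L (suc y) true N k
    count-after hor L y b zero k = count-none _ (λ _ → refl) (words L)
    count-after hor L y false (suc N) k = count-words L y false N k
    count-after hor L y true (suc N) k = count-words L y false N k
    count-after v L zero b N k = count-none _ (λ w → cong (_∧ _) (∧-zeroʳ (does (xlen w ≟ N)))) (words L)
    count-after v L (suc y) false N k = count-words L y false N k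
    count-after v L (suc y) true N k = count-words L y false N k
    count-after d L zero b N k = count-none _ (λ w → cong (_∧ _) (∧-zeroʳ (does (suc (xlen w) ≟ N)))) (words L)
    count-after d L (suc y) b zero k = count-none _ (λ _ → refl) (words L)
    count-after d L (suc y) false (suc N) k = count-words L y false N k
    count-after d L (suc y) true (suc N) zero = count-none _ (λ _ → ∧-zeroʳ _) (words L)
    count-after d L (suc y) true (suc N) (suc k) = count-words L y false N k

  sumBelow : ℕ → (ℕ → ℕ) → ℕ
  sumBelow zero f = 0
  sumBelow (suc M) f = sumBelow M f + f M

  sumBelow-cong : ∀ M {f g : ℕ → ℕ} → (∀ x → f x ≡ g x) → sumBelow M f ≡ sumBelow M g
  sumBelow-cong zero f≡g = refl
  sumBelow-cong (suc M) f≡g = cong₂ _+_ (sumBelow-cong M f≡g) (f≡g M)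

  sumBelow-+ : ∀ a b f → sumBelow (a + b) f ≡ sumBelow a f + sumBelow b (λ x → f (a + x))
  sumBelow-+ a zero f = trans (cong (λ c → sumBelow c f) (+-identityʳ a)) (sym (+-identityʳ _))
  sumBelow-+ a (suc b) f = trans (cong (λ c → sumBelow c f) (+-suc a b))
    (trans (cong (_+ f (a + b)) (sumBelow-+ a b f)) (+-assoc (sumBelow a f) _ _))

  sumBelow-vanishes : ∀ M f → (∀ x → x < M → f x ≡ 0) → sumBelow M f ≡ 0
  sumBelow-vanishes zero f f≡0 = refl
  sumBelow-vanishes (suc M) f f≡0 =
    cong₂ _+_ (sumBelow-vanishes M f (λ x x<M → f≡0 x (m<n⇒m<1+n x<M))) (f≡0 M (n<1+n M))

  count-wordsUpTo : ∀ P M → count P (wordsUpTo M) ≡ sumBelow (suc M) (λ L → count P (words L))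
  count-wordsUpTo P zero = refl
  count-wordsUpTo P (suc M) = trans (count-++ P (wordsUpTo M) (words (suc M))) (cong (_+ count P (words (suc M))) (count-wordsUpTo P M))

  L-ud≡sum-paths : ∀ N i → L-ud N i ≡ sumBelow (suc (2 * N)) (λ L → paths L 0 false N i)
  L-ud≡sum-paths N i = begin
    L-ud N i                                                        ≡⟨ length-filter≡count _ (wordsUpTo (2 * N)) ⟩
    count (accepts 0 false N i) (wordsUpTo (2 * N))                 ≡⟨ count-wordsUpTo (accepts 0 false N i) (2 * N) ⟩
    sumBelow (suc (2 * N)) (λ L → count (accepts 0 false N i) (words L)) ≡⟨ sumBelow-cong (suc (2 * N)) (λ L → count-words L 0 false N i) ⟩
    sumBelow (suc (2 * N)) (λ L → paths L 0 false N i)              ∎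
    where open ≡-Reasoning

  -- A property of the parameters that rules out the empty word and is inherited by every
  -- one-letter suffix rules out every word.
  record Obstruction (Bad : ℕ → ℕ → Bool → ℕ → ℕ → Set) : Set where
    field
      empty : ∀ {y b N k} → Bad 0 y b N k → emptyCount y N k ≡ 0
      afterU : ∀ {L y b N k} → Bad (suc L) y b (suc N) k → Bad L (suc y) true N k
      afterH : ∀ {L y b N k} → Bad (suc L) y b (suc N) k → Bad L y false N k
      afterV : ∀ {L y b N k} → Bad (suc L) (suc y) b N k → Bad L y false N k
      afterD : ∀ {L y N k} → Bad (suc L) (suc y) false (suc N) k → Bad L y false N k
      afterPeak : ∀ {L y N k} → Bad (suc L) (suc y) true (suc N) (suc k) → Bad L y false N k

  module _ {Bad} (O : Obstruction Bad) where
    open Obstruction O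

    mutual
      paths-obstructed : ∀ {L y b N k} → Bad L y b N k → paths L y b N k ≡ 0
      paths-obstructed {zero} bad = empty bad
      paths-obstructed {suc L} bad =
        cong₂ _+_ (cong₂ _+_ (cong₂ _+_ (after-obstructed u bad) (after-obstructed hor bad)) (after-obstructed v bad))
                  (after-obstructed d bad)

      after-obstructed : ∀ s {L y b N k} → Bad (suc L) y b N k → pathsAfter s L y b N k ≡ 0
      after-obstructed u {N = zero} bad = refl
      after-obstructed u {N = suc N} bad = paths-obstructed (afterU bad)
      after-obstructed hor {N = zero} bad = refl
      after-obstructed hor {N = suc N} bad = paths-obstructed (afterH bad)
      after-obstructed v {y = zero} bad = refl
      after-obstructed v {y = suc y} bad = paths-obstructed (afterV bad)
      after-obstructed d {y = zero} bad = refl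
      after-obstructed d {y = suc y} {N = zero} bad = refl
      after-obstructed d {y = suc y} {false} {suc N} bad = paths-obstructed (afterD bad)
      after-obstructed d {y = suc y} {true} {suc N} {zero} bad = refl
      after-obstructed d {y = suc y} {true} {suc N} {suc k} bad = paths-obstructed (afterPeak bad)

    pathsNoD-obstructed : ∀ {L y b N k} → Bad L y b N k → pathsNoD L y b N k ≡ 0
    pathsNoD-obstructed {zero} bad = empty bad
    pathsNoD-obstructed {suc L} bad = m+n≡0⇒m≡0 _ (paths-obstructed bad)

  emptyCount-suc : ∀ y N k → emptyCount y N (suc k) ≡ 0
  emptyCount-suc zero zero k = refl
  emptyCount-suc zero (suc N) k = refl
  emptyCount-suc (suc y) N k = refl

  [2+a]<[1+k]+[1+k]⇒a<k+k : ∀ {a k} → suc (suc a) < suc k + suc k → a < k + k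
  [2+a]<[1+k]+[1+k]⇒a<k+k {a} {k} p rewrite +-suc k k = ≤-pred (≤-pred p)

  -- Every peak but a pending one uses up two horizontal units.
  tooManyPeaksForWidth : Obstruction (λ L y b N k → bit b + N < k + k)
  tooManyPeaksForWidth = record
    { empty = λ { {y} {b} {N} {suc k} _ → emptyCount-suc y N k }
    ; afterU = λ {_} {_} {b} bad → ≤-<-trans (m≤n+m _ (bit b)) bad
    ; afterH = λ {_} {_} {b} {N} bad → ≤-<-trans (≤-trans (n≤1+n N) (m≤n+m _ (bit b))) bad
    ; afterV = λ {_} {_} {b} bad → ≤-<-trans (m≤n+m _ (bit b)) bad
    ; afterD = λ bad → ≤-<-trans (n≤1+n _) bad
    ; afterPeak = [2+a]<[1+k]+[1+k]⇒a<k+k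
    }

  tooManyPeaksForLength : Obstruction (λ L y b N k → bit b + L < k + k)
  tooManyPeaksForLength = record
    { empty = λ { {y} {b} {N} {suc k} _ → emptyCount-suc y N k }
    ; afterU = λ {_} {_} {b} bad → ≤-<-trans (m≤n+m _ (bit b)) bad
    ; afterH = λ {L} {_} {b} bad → ≤-<-trans (≤-trans (n≤1+n L) (m≤n+m _ (bit b))) bad
    ; afterV = λ {L} {_} {b} bad → ≤-<-trans (≤-trans (n≤1+n L) (m≤n+m _ (bit b))) bad
    ; afterD = λ bad → ≤-<-trans (n≤1+n _) bad
    ; afterPeak = [2+a]<[1+k]+[1+k]⇒a<k+k
    }

  tooLongForPeaks : Obstruction (λ L y b N k → N + N + y < L + (k + k))
  tooLongForPeaks = record
    { empty = λ { {zero} {N = zero} {zero} () ; {zero} {N = zero} {suc k} _ → refl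
                ; {zero} {N = suc N} _ → refl ; {suc y} _ → refl }
    ; afterU = λ {L} {y} {_} {N} {k} bad → afterU′ L y N k bad
    ; afterH = λ {L} {y} {_} {N} {k} bad → afterH′ L y N k bad
    ; afterV = λ {L} {y} {_} {N} {k} bad → afterV′ L y N k bad
    ; afterD = λ {L} {y} {N} {k} bad → afterD′ L y N k bad
    ; afterPeak = λ {L} {y} {N} {k} bad → afterPeak′ L y N k bad
    }
    where
    afterU′ : ∀ L y N k → suc N + suc N + y < suc L + (k + k) → N + N + suc y < L + (k + k)
    afterU′ L y N k p rewrite +-suc N N | +-suc (N + N) y = ≤-pred p
    afterH′ : ∀ L y N k → suc N + suc N + y < suc L + (k + k) → N + N + y < L + (k + k)
    afterH′ L y N k p rewrite +-suc N N = ≤-pred (≤-trans (s≤s (n≤1+n _)) p)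
    afterV′ : ∀ L y N k → N + N + suc y < suc L + (k + k) → N + N + y < L + (k + k)
    afterV′ L y N k p rewrite +-suc (N + N) y = ≤-pred p
    afterD′ : ∀ L y N k → suc N + suc N + suc y < suc L + (k + k) → N + N + y < L + (k + k)
    afterD′ L y N k p rewrite +-suc N N | +-suc (N + N) y = ≤-pred (≤-trans (s≤s (n≤1+n _)) (≤-trans (n≤1+n _) p))
    afterPeak′ : ∀ L y N k → suc N + suc N + suc y < suc L + (suc k + suc k) → N + N + y < L + (k + k)
    afterPeak′ L y N k p rewrite +-suc N N | +-suc (N + N) y | +-suc k k | +-suc L (suc (k + k)) | +-suc L (k + k) =
      ≤-pred (≤-pred (≤-pred p))

  -- Peak-reduced counts: m peaks are fixed and ℓ, n are the word length and x-length
  -- left after discounting the 2m letters spent on them.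
  reduced : ℕ → ℕ → ℕ → ℕ → ℕ
  reduced ℓ n y m = paths (ℓ + 2 * m) y false (n + 2 * m) m

  reducedNoD : ℕ → ℕ → ℕ → ℕ → ℕ
  reducedNoD ℓ n y m = pathsNoD (ℓ + 2 * m) y false (n + 2 * m) m

  reducedAfter : Step → ℕ → ℕ → ℕ → ℕ → ℕ
  reducedAfter u ℓ zero y m = 0
  reducedAfter u ℓ (suc n) y m = reducedNoD ℓ n (suc y) m
  reducedAfter hor ℓ zero y m = 0
  reducedAfter hor ℓ (suc n) y m = reduced ℓ n y m
  reducedAfter v ℓ n zero m = 0
  reducedAfter v ℓ n (suc y) m = reduced ℓ n y m
  reducedAfter d ℓ n zero m = 0
  reducedAfter d ℓ zero (suc y) m = 0
  reducedAfter d ℓ (suc n) (suc y) m = reduced ℓ n y m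

  +2*suc : ∀ a m → a + 2 * suc m ≡ suc (suc (a + 2 * m))
  +2*suc = solve 2 (λ a m → a :+ con 2 :* (con 1 :+ m) := con 2 :+ (a :+ con 2 :* m)) refl

  odd<double : ∀ m → suc (2 * m) < suc m + suc m
  odd<double m rewrite +-identityʳ m | +-suc m m = ≤-refl

  reduced-suc : ∀ ℓ n y m → reduced (suc ℓ) n y m ≡ reducedNoD (suc ℓ) n y m + reducedAfter d ℓ n y m
  reduced-suc ℓ n y m = cong (reducedNoD (suc ℓ) n y m +_) (leading-d n y m)
    where
    leading-d : ∀ n y m → pathsAfter d (ℓ + 2 * m) y false (n + 2 * m) m ≡ reducedAfter d ℓ n y m
    leading-d n zero m = refl
    leading-d (suc n) (suc y) m = refl
    leading-d zero (suc y) zero = refl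
    leading-d zero (suc y) (suc m) = paths-obstructed tooManyPeaksForWidth {ℓ + 2 * suc m} {y} {false} {k = suc m}
      (subst (_< suc m + suc m) (sym (+-suc m (m + 0))) (odd<double m))

  -- A leading u followed by d is a peak; deleting it gives the first summand.
  reducedNoD-suc : ∀ ℓ n y m → reducedNoD (suc ℓ) n y (suc m) ≡
    reduced (suc ℓ) n y m + (reducedAfter u ℓ n y (suc m) + reducedAfter hor ℓ n y (suc m) + reducedAfter v ℓ n y (suc m))
  reducedNoD-suc ℓ n y m =
    trans (cong₂ (λ L N → pathsNoD L y false N (suc m)) (+2*suc (suc ℓ) m) (+2*suc n m))
    (trans (cong₂ _+_ (cong₂ _+_ (cong (_+ reduced (suc ℓ) n y m) (afterU n)) (afterH n)) (afterV y))
      (solve 4 (λ r a b c → a :+ r :+ b :+ c := r :+ (a :+ b :+ c)) refl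
        (reduced (suc ℓ) n y m) (reducedAfter u ℓ n y (suc m)) (reducedAfter hor ℓ n y (suc m)) (reducedAfter v ℓ n y (suc m))))
    where
    L = suc (suc ℓ + 2 * m)
    N = n + 2 * m
    shifted : ∀ {ℓ n} (count : ℕ → ℕ → ℕ) → count (suc (suc (ℓ + 2 * m))) (suc (suc (n + 2 * m))) ≡ count (ℓ + 2 * suc m) (n + 2 * suc m)
    shifted count = sym (cong₂ count (+2*suc _ m) (+2*suc _ m))
    afterU : ∀ n → pathsNoD L (suc y) true (suc (n + 2 * m)) (suc m) ≡ reducedAfter u ℓ n y (suc m)
    afterU zero = pathsNoD-obstructed tooManyPeaksForWidth {L} {suc y} {false} {k = suc m} (odd<double m)
    afterU (suc n) = shifted {ℓ} {n} (λ L N → pathsNoD L (suc y) false N (suc m))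
    afterH : ∀ n → paths L y false (suc (n + 2 * m)) (suc m) ≡ reducedAfter hor ℓ n y (suc m)
    afterH zero = paths-obstructed tooManyPeaksForWidth {L} {y} {false} {k = suc m} (odd<double m)
    afterH (suc n) = shifted {ℓ} {n} (λ L N → paths L y false N (suc m))
    afterV : ∀ y → pathsAfter v L y false (suc (suc N)) (suc m) ≡ reducedAfter v ℓ n y (suc m)
    afterV zero = refl
    afterV (suc y) = shifted {ℓ} {n} (λ L N → paths L y false N (suc m))

  -- With ℓ = 0 every letter outside the m peaks is forbidden, so the counts do not depend on m.
  module _ (n y m : ℕ) where
    private
      N = n + 2 * m
      shifted : ∀ (count : ℕ → ℕ → ℕ) → count (0 + 2 * suc m) (n + 2 * suc m) ≡ count (suc (suc (2 * m))) (suc (suc N))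
      shifted count = cong₂ count (+2*suc 0 m) (+2*suc n m)
      tooManyPeaks : ∀ y N → paths (suc (2 * m)) y false N (suc m) ≡ 0
      tooManyPeaks y N = paths-obstructed tooManyPeaksForLength {y = y} {false} {N} {suc m} (odd<double m)

    reduced-zero-suc : reduced 0 n y (suc m) ≡ reducedNoD 0 n y (suc m)
    reduced-zero-suc = begin
        reduced 0 n y (suc m)
      ≡⟨ shifted (λ L N → paths L y false N (suc m)) ⟩
        pathsNoD (suc (suc (2 * m))) y false (suc (suc N)) (suc m) + pathsAfter d (suc (2 * m)) y false (suc (suc N)) (suc m)
      ≡⟨ cong (pathsNoD (suc (suc (2 * m))) y false (suc (suc N)) (suc m) +_) (leading-d y) ⟩
        pathsNoD (suc (suc (2 * m))) y false (suc (suc N)) (suc m) + 0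
      ≡⟨ +-identityʳ _ ⟩
        pathsNoD (suc (suc (2 * m))) y false (suc (suc N)) (suc m)
      ≡⟨ shifted (λ L N → pathsNoD L y false N (suc m)) ⟨
        reducedNoD 0 n y (suc m) ∎
      where
      open ≡-Reasoning
      leading-d : ∀ y → pathsAfter d (suc (2 * m)) y false (suc (suc N)) (suc m) ≡ 0
      leading-d zero = refl
      leading-d (suc y) = tooManyPeaks y (suc N)

    reducedNoD-zero-suc : reducedNoD 0 n y (suc m) ≡ reduced 0 n y m
    reducedNoD-zero-suc = begin
        reducedNoD 0 n y (suc m)
      ≡⟨ shifted (λ L N → pathsNoD L y false N (suc m)) ⟩
        pathsNoD (suc (2 * m)) (suc y) false (suc N) (suc m) + reduced 0 n y m
          + paths (suc (2 * m)) y false (suc N) (suc m) + pathsAfter v (suc (2 * m)) y false (suc (suc N)) (suc m)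
      ≡⟨ cong₂ _+_ (cong₂ _+_ (cong (_+ reduced 0 n y m) after-u) (tooManyPeaks y (suc N))) (after-v y) ⟩
        0 + reduced 0 n y m + 0 + 0
      ≡⟨ solve 1 (λ r → con 0 :+ r :+ con 0 :+ con 0 := r) refl (reduced 0 n y m) ⟩
        reduced 0 n y m ∎
      where
      open ≡-Reasoning
      after-u : pathsNoD (suc (2 * m)) (suc y) false (suc N) (suc m) ≡ 0
      after-u = pathsNoD-obstructed tooManyPeaksForLength {y = suc y} {false} {suc N} {suc m} (odd<double m)
      after-v : ∀ y → pathsAfter v (suc (2 * m)) y false (suc (suc N)) (suc m) ≡ 0
      after-v zero = refl
      after-v (suc y) = tooManyPeaks y (suc (suc N))

  reduced-zero : ∀ n y m → reduced 0 n y m ≡ emptyCount y n 0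
  reduced-zero n y zero = cong (λ N → emptyCount y N 0) (+-identityʳ n)
  reduced-zero n y (suc m) = trans (reduced-zero-suc n y m) (trans (reducedNoD-zero-suc n y m) (reduced-zero n y m))

  reducedNoD-zero : ∀ n y m → reducedNoD 0 n y m ≡ emptyCount y n 0
  reducedNoD-zero n y zero = cong (λ N → emptyCount y N 0) (+-identityʳ n)
  reducedNoD-zero n y (suc m) = trans (reducedNoD-zero-suc n y m) (reduced-zero n y m)

  L-ud≡sum-reduced : ∀ n m → L-ud (n + 2 * m) m ≡ sumBelow (suc (2 * n)) (λ ℓ → reduced ℓ n 0 m)
  L-ud≡sum-reduced n m = begin
      L-ud N m
    ≡⟨ L-ud≡sum-paths N m ⟩
      sumBelow (suc (2 * N)) f
    ≡⟨ cong (λ M → sumBelow M f) split ⟩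
      sumBelow (2 * m + (suc (2 * n) + 2 * m)) f
    ≡⟨ sumBelow-+ (2 * m) _ f ⟩
      sumBelow (2 * m) f + sumBelow (suc (2 * n) + 2 * m) (λ ℓ → f (2 * m + ℓ))
    ≡⟨ cong₂ _+_ too-short (sumBelow-+ (suc (2 * n)) (2 * m) _) ⟩
      0 + (sumBelow (suc (2 * n)) (λ ℓ → f (2 * m + ℓ)) + sumBelow (2 * m) (λ ℓ → f (2 * m + (suc (2 * n) + ℓ))))
    ≡⟨ cong (sumBelow (suc (2 * n)) (λ ℓ → f (2 * m + ℓ)) +_) too-long ⟩
      sumBelow (suc (2 * n)) (λ ℓ → f (2 * m + ℓ)) + 0
    ≡⟨ +-identityʳ _ ⟩
      sumBelow (suc (2 * n)) (λ ℓ → f (2 * m + ℓ))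
    ≡⟨ sumBelow-cong (suc (2 * n)) (λ ℓ → cong (λ L → paths L 0 false N m) (+-comm (2 * m) ℓ)) ⟩
      sumBelow (suc (2 * n)) (λ ℓ → reduced ℓ n 0 m) ∎
    where
    open ≡-Reasoning
    N = n + 2 * m
    f : ℕ → ℕ
    f L = paths L 0 false N m
    split : suc (2 * N) ≡ 2 * m + (suc (2 * n) + 2 * m)
    split = solve 2 (λ n m → con 1 :+ con 2 :* (n :+ con 2 :* m) := con 2 :* m :+ ((con 1 :+ con 2 :* n) :+ con 2 :* m)) refl n m
    too-short : sumBelow (2 * m) f ≡ 0
    too-short = sumBelow-vanishes (2 * m) f (λ L L<2m →
      paths-obstructed tooManyPeaksForLength {L} {0} {false} {N} {m} (subst (L <_) (cong (m +_) (+-identityʳ m)) L<2m))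
    too-long : sumBelow (2 * m) (λ ℓ → f (2 * m + (suc (2 * n) + ℓ))) ≡ 0
    too-long = sumBelow-vanishes (2 * m) _ (λ ℓ _ →
      paths-obstructed tooLongForPeaks {2 * m + (suc (2 * n) + ℓ)} {0} {false} {N} {m} (≤-trans (m≤m+n _ ℓ) (≤-reflexive
        (solve 3 (λ n m ℓ → con 1 :+ ((n :+ con 2 :* m) :+ (n :+ con 2 :* m) :+ con 0) :+ ℓ
                          := con 2 :* m :+ ((con 1 :+ con 2 :* n) :+ ℓ) :+ (m :+ m)) refl n m ℓ))))

module Walks where

  open import Defs renaming (h to hor)
  open Paths using (emptyCount)
  open import Data.Nat using (ℕ; zero; suc; _+_; _*_; _∸_; _≤_; _<_; s≤s; _/_)
  open import Data.Nat.Properties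
  open import Data.Nat.Combinatorics using (_C_; k>n⇒nCk≡0; nCk+nC[k+1]≡[n+1]C[k+1]; nCk≡nC[n∸k]; nC1≡n)
  open import Data.Nat.DivMod using (m*n/n≡m)
  open import Relation.Nullary using (yes; no)
  open import Relation.Binary.PropositionalEquality
  open import Data.Nat.Solver using (module +-*-Solver)
  open +-*-Solver

  -- walks ℓ n y counts the words of length ℓ and x-length n that descend from height y to 0
  -- without going below the axis.
  mutual
    walks : ℕ → ℕ → ℕ → ℕ
    walks zero n y = emptyCount y n 0
    walks (suc ℓ) n y = walksAfter u ℓ n y + walksAfter hor ℓ n y + walksAfter v ℓ n y + walksAfter d ℓ n y

    walksAfter : Step → ℕ → ℕ → ℕ → ℕ
    walksAfter u ℓ zero y = 0
    walksAfter u ℓ (suc n) y = walks ℓ n (suc y)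
    walksAfter hor ℓ zero y = 0
    walksAfter hor ℓ (suc n) y = walks ℓ n y
    walksAfter v ℓ n zero = 0
    walksAfter v ℓ n (suc y) = walks ℓ n y
    walksAfter d ℓ n zero = 0
    walksAfter d ℓ zero (suc y) = 0
    walksAfter d ℓ (suc n) (suc y) = walks ℓ n y

  mutual
    walks-tooLong : ∀ ℓ n y → n + n + y < ℓ → walks ℓ n y ≡ 0
    walks-tooLong (suc ℓ) n y long =
      cong₂ _+_ (cong₂ _+_ (cong₂ _+_ (walksAfter-tooLong u n y long) (walksAfter-tooLong hor n y long))
                            (walksAfter-tooLong v n y long)) (walksAfter-tooLong d n y long)

    walksAfter-tooLong : ∀ s {ℓ} n y → n + n + y < suc ℓ → walksAfter s ℓ n y ≡ 0
    walksAfter-tooLong u zero y long = refl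
    walksAfter-tooLong u {ℓ} (suc n) y long = walks-tooLong ℓ n (suc y) (subst (_≤ ℓ) eq (≤-pred long))
      where
      eq : suc n + suc n + y ≡ suc (n + n + suc y)
      eq = solve 2 (λ n y → con 1 :+ n :+ (con 1 :+ n) :+ y := con 1 :+ (n :+ n :+ (con 1 :+ y))) refl n y
    walksAfter-tooLong hor zero y long = refl
    walksAfter-tooLong hor {ℓ} (suc n) y long = walks-tooLong ℓ n y (≤-trans (s≤s (≤-trans (n≤1+n _) (≤-reflexive eq))) (≤-pred long))
      where
      eq : suc (n + n + y) ≡ n + suc n + y
      eq = cong (_+ y) (sym (+-suc n n))
    walksAfter-tooLong v n zero long = refl
    walksAfter-tooLong v {ℓ} n (suc y) long = walks-tooLong ℓ n y (subst (_≤ ℓ) (+-suc (n + n) y) (≤-pred long))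
    walksAfter-tooLong d n zero long = refl
    walksAfter-tooLong d zero (suc y) long = refl
    walksAfter-tooLong d {ℓ} (suc n) (suc y) long = walks-tooLong ℓ n y (≤-trans (s≤s (≤-trans (n≤1+n _) (≤-trans (n≤1+n _) (≤-reflexive eq)))) (≤-pred long))
      where
      eq : suc (suc (n + n + y)) ≡ n + suc n + suc y
      eq = solve 2 (λ n y → con 2 :+ (n :+ n :+ y) := n :+ (con 1 :+ n) :+ (con 1 :+ y)) refl n y

  -- Of length 2n + y, such a walk has n up and n + y vertical steps only.
  ballot : ℕ → ℕ → ℕ
  ballot n y = walks (n + n + y) n y

  ballot-zero : ∀ y → ballot 0 y ≡ 1
  ballot-zero zero = refl
  ballot-zero (suc y) = trans (+-identityʳ _) (ballot-zero y)

  ballot-suc-zero : ∀ n → ballot (suc n) 0 ≡ ballot n 1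
  ballot-suc-zero n = begin
      walks (suc n + suc n + 0) (suc n) 0
    ≡⟨ cong (λ ℓ → walks ℓ (suc n) 0) (+-identityʳ (suc n + suc n)) ⟩
      walks (n + suc n) n 1 + walks (n + suc n) n 0 + 0 + 0
    ≡⟨ cong (λ w → w + 0 + 0) (cong₂ _+_ (cong (λ ℓ → walks ℓ n 1) length) (walks-tooLong (n + suc n) n 0 long)) ⟩
      ballot n 1 + 0 + 0 + 0
    ≡⟨ solve 1 (λ b → b :+ con 0 :+ con 0 :+ con 0 := b) refl (ballot n 1) ⟩
      ballot n 1 ∎
    where
    open ≡-Reasoning
    length : n + suc n ≡ n + n + 1
    length = solve 1 (λ n → n :+ (con 1 :+ n) := n :+ n :+ con 1) refl n
    long : n + n + 0 < n + suc n
    long = ≤-reflexive (solve 1 (λ n → con 1 :+ (n :+ n :+ con 0) := n :+ (con 1 :+ n)) refl n)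

  ballot-suc-suc : ∀ n y → ballot (suc n) (suc y) ≡ ballot n (suc (suc y)) + ballot (suc n) y
  ballot-suc-suc n y = begin
      walks X n (suc (suc y)) + walks X n (suc y) + walks X (suc n) y + walks X n y
    ≡⟨ cong₂ _+_ (cong₂ _+_ (cong₂ _+_ (cong (λ ℓ → walks ℓ n (suc (suc y))) lengthU) (walks-tooLong X n (suc y) longH))
                            (cong (λ ℓ → walks ℓ (suc n) y) lengthV)) (walks-tooLong X n y longD) ⟩
      ballot n (suc (suc y)) + 0 + ballot (suc n) y + 0
    ≡⟨ solve 2 (λ a b → a :+ con 0 :+ b :+ con 0 := a :+ b) refl (ballot n (suc (suc y))) (ballot (suc n) y) ⟩
      ballot n (suc (suc y)) + ballot (suc n) y ∎
    where
    open ≡-Reasoning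
    X = n + suc n + suc y
    lengthU : X ≡ n + n + suc (suc y)
    lengthU = solve 2 (λ n y → n :+ (con 1 :+ n) :+ (con 1 :+ y) := n :+ n :+ (con 2 :+ y)) refl n y
    lengthV : X ≡ suc n + suc n + y
    lengthV = solve 2 (λ n y → n :+ (con 1 :+ n) :+ (con 1 :+ y) := con 1 :+ n :+ (con 1 :+ n) :+ y) refl n y
    longH : n + n + suc y < X
    longH = ≤-reflexive (solve 2 (λ n y → con 1 :+ (n :+ n :+ (con 1 :+ y)) := n :+ (con 1 :+ n) :+ (con 1 :+ y)) refl n y)
    longD : n + n + y < X
    longD = ≤-trans (s≤s (≤-trans (n≤1+n _) (≤-reflexive (sym (+-suc (n + n) y))))) longH

  -- M C (n − 1), read as 0 when n = 0 (unlike M C (n ∸ 1)).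
  C-pred : ℕ → ℕ → ℕ
  C-pred M zero = 0
  C-pred M (suc n) = M C n

  C-pred-pascal : ∀ M n → C-pred M n + M C n ≡ suc M C n
  C-pred-pascal M zero = refl
  C-pred-pascal M (suc n) = nCk+nC[k+1]≡[n+1]C[k+1] M n

  ballot-binomial : ∀ n y → ballot n y + C-pred (n + n + y) n ≡ (n + n + y) C n
  ballot-binomial zero y = trans (+-identityʳ _) (ballot-zero y)
  ballot-binomial (suc n) zero = begin
      ballot (suc n) 0 + M C n
    ≡⟨ cong (_+ M C n) (ballot-suc-zero n) ⟩
      ballot n 1 + M C n
    ≡⟨ cong (ballot n 1 +_) (trans (C-pred-pascal M′ n) (cong (_C n) (sym M≡1+M′))) ⟨
      ballot n 1 + (C-pred M′ n + M′ C n)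
    ≡⟨ +-assoc (ballot n 1) _ _ ⟨
      ballot n 1 + C-pred M′ n + M′ C n
    ≡⟨ cong (_+ M′ C n) (ballot-binomial n 1) ⟩
      M′ C n + M′ C n
    ≡⟨ cong (M′ C n +_) middle ⟩
      M′ C n + M′ C suc n
    ≡⟨ nCk+nC[k+1]≡[n+1]C[k+1] M′ n ⟩
      suc M′ C suc n
    ≡⟨ cong (_C suc n) M≡1+M′ ⟨
      M C suc n ∎
    where
    open ≡-Reasoning
    M = suc n + suc n + 0
    M′ = n + n + 1
    M≡1+M′ : M ≡ suc M′
    M≡1+M′ = solve 1 (λ n → con 1 :+ n :+ (con 1 :+ n) :+ con 0 := con 1 :+ (n :+ n :+ con 1)) refl n
    middle : M′ C n ≡ M′ C suc n
    middle = trans (nCk≡nC[n∸k] (≤-trans (m≤m+n n n) (m≤m+n _ 1)))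
      (cong (M′ C_) (trans (cong (_∸ n) (solve 1 (λ n → n :+ n :+ con 1 := con 1 :+ n :+ n) refl n)) (m+n∸n≡m (suc n) n)))
  ballot-binomial (suc n) (suc y) = begin
      ballot (suc n) (suc y) + C-pred (suc n + suc n + suc y) (suc n)
    ≡⟨ cong₂ _+_ (ballot-suc-suc n y) (cong (_C n) (+-suc (suc n + suc n) y)) ⟩
      ballot n (suc (suc y)) + ballot (suc n) y + suc M C n
    ≡⟨ cong (ballot n (suc (suc y)) + ballot (suc n) y +_) (C-pred-pascal M n) ⟨
      ballot n (suc (suc y)) + ballot (suc n) y + (C-pred M n + M C n)
    ≡⟨ solve 4 (λ a b c e → a :+ b :+ (c :+ e) := (a :+ c) :+ (b :+ e)) refl (ballot n (suc (suc y))) (ballot (suc n) y) (C-pred M n) (M C n) ⟩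
      (ballot n (suc (suc y)) + C-pred M n) + (ballot (suc n) y + M C n)
    ≡⟨ cong₂ _+_ (trans (cong (λ M → ballot n (suc (suc y)) + C-pred M n) M≡) (trans (ballot-binomial n (suc (suc y))) (cong (_C n) (sym M≡))))
                 (ballot-binomial (suc n) y) ⟩
      M C n + M C suc n
    ≡⟨ nCk+nC[k+1]≡[n+1]C[k+1] M n ⟩
      suc M C suc n
    ≡⟨ cong (_C suc n) (+-suc (suc n + suc n) y) ⟨
      (suc n + suc n + suc y) C suc n ∎
    where
    open ≡-Reasoning
    M = suc n + suc n + y
    M≡ : M ≡ n + n + suc (suc y)
    M≡ = solve 2 (λ n y → con 1 :+ n :+ (con 1 :+ n) :+ y := n :+ n :+ (con 2 :+ y)) refl n y

  [m∸k]*mCk≡[1+k]*mC[1+k] : ∀ m k → (m ∸ k) * (m C k) ≡ suc k * (m C suc k)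
  [m∸k]*mCk≡[1+k]*mC[1+k] zero zero = refl
  [m∸k]*mCk≡[1+k]*mC[1+k] zero (suc k) = sym (*-zeroʳ (suc (suc k)))
  [m∸k]*mCk≡[1+k]*mC[1+k] (suc m) zero = trans (*-identityʳ (suc m)) (sym (trans (+-identityʳ _) (nC1≡n (suc m))))
  [m∸k]*mCk≡[1+k]*mC[1+k] (suc m) (suc k) with k <? m
  ... | yes k<m = begin
      (m ∸ k) * (suc m C suc k)
    ≡⟨ cong ((m ∸ k) *_) (nCk+nC[k+1]≡[n+1]C[k+1] m k) ⟨
      (m ∸ k) * (m C k + m C suc k)
    ≡⟨ *-distribˡ-+ (m ∸ k) (m C k) (m C suc k) ⟩
      (m ∸ k) * (m C k) + (m ∸ k) * (m C suc k)
    ≡⟨ cong₂ _+_ ([m∸k]*mCk≡[1+k]*mC[1+k] m k) (cong (_* (m C suc k)) (+-∸-assoc 1 k<m)) ⟩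
      suc k * (m C suc k) + suc (m ∸ suc k) * (m C suc k)
    ≡⟨ solve 3 (λ k a c → (con 1 :+ k) :* c :+ (con 1 :+ a) :* c := (con 2 :+ k) :* c :+ a :* c) refl k (m ∸ suc k) (m C suc k) ⟩
      suc (suc k) * (m C suc k) + (m ∸ suc k) * (m C suc k)
    ≡⟨ cong (suc (suc k) * (m C suc k) +_) ([m∸k]*mCk≡[1+k]*mC[1+k] m (suc k)) ⟩
      suc (suc k) * (m C suc k) + suc (suc k) * (m C suc (suc k))
    ≡⟨ *-distribˡ-+ (suc (suc k)) (m C suc k) (m C suc (suc k)) ⟨
      suc (suc k) * (m C suc k + m C suc (suc k))
    ≡⟨ cong (suc (suc k) *_) (nCk+nC[k+1]≡[n+1]C[k+1] m (suc k)) ⟩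
      suc (suc k) * (suc m C suc (suc k)) ∎
    where open ≡-Reasoning
  ... | no k≮m = begin
      (m ∸ k) * (suc m C suc k)           ≡⟨ cong (_* (suc m C suc k)) (m≤n⇒m∸n≡0 (≮⇒≥ k≮m)) ⟩
      0                                   ≡⟨ *-zeroʳ (suc (suc k)) ⟨
      suc (suc k) * 0                     ≡⟨ cong (suc (suc k) *_) (k>n⇒nCk≡0 (s≤s (s≤s (≮⇒≥ k≮m)))) ⟨
      suc (suc k) * (suc m C suc (suc k)) ∎
    where open ≡-Reasoning

  walks≡catalan : ∀ n → walks (2 * n) n 0 ≡ catalan n
  walks≡catalan zero = refl
  walks≡catalan (suc n) = begin
      walks (2 * suc n) (suc n) 0
    ≡⟨ cong (λ ℓ → walks ℓ (suc n) 0) 2*≡ ⟩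
      b
    ≡⟨ m*n/n≡m b (suc (suc n)) ⟨
      (b * suc (suc n)) / suc (suc n)
    ≡⟨ cong (_/ suc (suc n)) (trans (*-comm b (suc (suc n))) b*[n+2]≡c) ⟩
      c / suc (suc n)
    ≡⟨ cong (λ M → (M C suc n) / suc (suc n)) 2*≡ ⟨
      catalan (suc n) ∎
    where
    open ≡-Reasoning
    M = suc n + suc n + 0
    b = ballot (suc n) 0
    c = M C suc n
    c′ = M C n
    2*≡ : 2 * suc n ≡ M
    2*≡ = solve 1 (λ n → con 2 :* (con 1 :+ n) := con 1 :+ n :+ (con 1 :+ n) :+ con 0) refl n
    M∸n≡n+2 : M ∸ n ≡ suc (suc n)
    M∸n≡n+2 = trans (cong (_∸ n) (solve 1 (λ n → con 1 :+ n :+ (con 1 :+ n) :+ con 0 := con 2 :+ n :+ n) refl n)) (m+n∸n≡m (suc (suc n)) n)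
    -- (n + 2) b = (n + 2) c − (n + 2) c′ = (n + 2) c − (n + 1) c = c
    b*[n+2]≡c : suc (suc n) * b ≡ c
    b*[n+2]≡c = +-cancelʳ-≡ (suc n * c) _ _ (begin
        suc (suc n) * b + suc n * c
      ≡⟨ cong (suc (suc n) * b +_) (trans (cong (_* c′) (sym M∸n≡n+2)) ([m∸k]*mCk≡[1+k]*mC[1+k] M n)) ⟨
        suc (suc n) * b + suc (suc n) * c′
      ≡⟨ *-distribˡ-+ (suc (suc n)) b c′ ⟨
        suc (suc n) * (b + c′)
      ≡⟨ cong (suc (suc n) *_) (ballot-binomial (suc n) 0) ⟩
        c + suc n * c ∎)

module PeakPolynomials where

  open import Defs using (u; d; v; L-ud; sumTo) renaming (h to hor)
  open FiniteDifferences
  open Paths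
  open Walks
  open import Data.Nat as ℕ using (ℕ; zero; suc)
  import Data.Nat.Properties as ℕ
  open import Data.Integer using (+_; _+_; _-_)
  open import Data.Integer.Properties using (pos-+)
  open import Data.Integer.Solver using (module +-*-Solver)
  open +-*-Solver using (solve; _:=_; _:+_; _:-_)
  open import Data.Product using (_×_; _,_; proj₁; proj₂)
  open import Relation.Binary.PropositionalEquality

  poly-+ℕ : ∀ {ℓ a b} {f g : ℕ → ℕ} → Polynomial ℓ (λ m → + f m) a → Polynomial ℓ (λ m → + g m) b →
            Polynomial ℓ (λ m → + (f m ℕ.+ g m)) (a ℕ.+ b)
  poly-+ℕ {f = f} {g} p q = poly-cong (λ m → sym (pos-+ (f m) (g m))) refl (poly-+ p q)

  PolynomialCounts : ℕ → Set
  PolynomialCounts ℓ = ∀ n y → Polynomial ℓ (λ m → + reduced ℓ n y m) (walks ℓ n y)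
                            × Polynomial ℓ (λ m → + reducedNoD ℓ n y m) (walks ℓ n y)

  reducedAfter-polynomial : ∀ {ℓ} → PolynomialCounts ℓ → ∀ s n y →
                            Polynomial ℓ (λ m → + reducedAfter s ℓ n y m) (walksAfter s ℓ n y)
  reducedAfter-polynomial {ℓ} P u zero y = poly-zero ℓ
  reducedAfter-polynomial P u (suc n) y = proj₂ (P n (suc y))
  reducedAfter-polynomial {ℓ} P hor zero y = poly-zero ℓ
  reducedAfter-polynomial P hor (suc n) y = proj₁ (P n y)
  reducedAfter-polynomial {ℓ} P v n zero = poly-zero ℓ
  reducedAfter-polynomial P v n (suc y) = proj₁ (P n y)
  reducedAfter-polynomial {ℓ} P d n zero = poly-zero ℓ
  reducedAfter-polynomial {ℓ} P d zero (suc y) = poly-zero ℓ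
  reducedAfter-polynomial P d (suc n) (suc y) = proj₁ (P n y)

  Δ-reducedNoD : ∀ ℓ n y m → Δ (λ m → + reducedNoD (suc ℓ) n y m) m ≡
    + (reducedAfter u ℓ n y (suc m) ℕ.+ reducedAfter hor ℓ n y (suc m) ℕ.+ reducedAfter v ℓ n y (suc m) ℕ.+ reducedAfter d ℓ n y m)
  Δ-reducedNoD ℓ n y m = begin
      + reducedNoD (suc ℓ) n y (suc m) - + reducedNoD (suc ℓ) n y m
    ≡⟨ cong (_- + reducedNoD (suc ℓ) n y m) (cong +_ (trans (reducedNoD-suc ℓ n y m) (cong (ℕ._+ uhv) (reduced-suc ℓ n y m)))) ⟩
      + (reducedNoD (suc ℓ) n y m ℕ.+ dm ℕ.+ uhv) - + reducedNoD (suc ℓ) n y m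
    ≡⟨ cong (_- + reducedNoD (suc ℓ) n y m) (trans (pos-+ (reducedNoD (suc ℓ) n y m ℕ.+ dm) uhv) (cong (_+ + uhv) (pos-+ (reducedNoD (suc ℓ) n y m) dm))) ⟩
      + reducedNoD (suc ℓ) n y m + + dm + + uhv - + reducedNoD (suc ℓ) n y m
    ≡⟨ solve 3 (λ r a b → r :+ a :+ b :- r := b :+ a) refl (+ reducedNoD (suc ℓ) n y m) (+ dm) (+ uhv) ⟩
      + uhv + + dm
    ≡⟨ pos-+ uhv dm ⟨
      + (uhv ℕ.+ dm) ∎
    where
    open ≡-Reasoning
    uhv = reducedAfter u ℓ n y (suc m) ℕ.+ reducedAfter hor ℓ n y (suc m) ℕ.+ reducedAfter v ℓ n y (suc m)
    dm = reducedAfter d ℓ n y m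

  polynomialCounts : ∀ ℓ → PolynomialCounts ℓ
  polynomialCounts zero n y = constant (reduced 0) reduced-zero , constant (reducedNoD 0) reducedNoD-zero
    where
    constant : ∀ f → (∀ n y m → f n y m ≡ emptyCount y n 0) → Polynomial 0 (λ m → + f n y m) (emptyCount y n 0)
    constant f f≡ = poly-cong (λ m → sym (cong +_ (f≡ n y m))) refl (poly-const _)
  polynomialCounts (suc ℓ) n y = reduced-polynomial , reducedNoD-polynomial
    where
    after : ∀ s → Polynomial ℓ (λ m → + reducedAfter s ℓ n y m) (walksAfter s ℓ n y)
    after s = reducedAfter-polynomial (polynomialCounts ℓ) s n y
    afterUHV : Polynomial ℓ (λ m → + (reducedAfter u ℓ n y m ℕ.+ reducedAfter hor ℓ n y m ℕ.+ reducedAfter v ℓ n y m))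
                            (walksAfter u ℓ n y ℕ.+ walksAfter hor ℓ n y ℕ.+ walksAfter v ℓ n y)
    afterUHV = poly-+ℕ (poly-+ℕ (after u) (after hor)) (after v)
    increment : Polynomial ℓ (Δ (λ m → + reducedNoD (suc ℓ) n y m)) (walks (suc ℓ) n y)
    increment = poly-cong (λ m → sym (Δ-reducedNoD ℓ n y m)) refl (poly-+ℕ (poly-shift afterUHV) (after d))
    reducedNoD-polynomial : Polynomial (suc ℓ) (λ m → + reducedNoD (suc ℓ) n y m) (walks (suc ℓ) n y)
    reducedNoD-polynomial = poly-Δ increment
    reduced-polynomial : Polynomial (suc ℓ) (λ m → + reduced (suc ℓ) n y m) (walks (suc ℓ) n y)
    reduced-polynomial = poly-cong (λ m → cong +_ (sym (reduced-suc ℓ n y m))) (ℕ.+-identityʳ _)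
      (poly-+ℕ reducedNoD-polynomial (poly-raise (after d)))

  +sumBelow≡sumTo : ∀ M (g : ℕ → ℕ) → + sumBelow (suc M) g ≡ sumTo M (λ ℓ → + g ℓ)
  +sumBelow≡sumTo zero g = refl
  +sumBelow≡sumTo (suc M) g = trans (pos-+ (sumBelow (suc M) g) (g (suc M))) (cong (_+ + g (suc M)) (+sumBelow≡sumTo M g))

  L-ud≡sumTo-reduced : ∀ n m → + L-ud (n ℕ.+ 2 ℕ.* m) m ≡ sumTo (2 ℕ.* n) (λ ℓ → + reduced ℓ n 0 m)
  L-ud≡sumTo-reduced n m = trans (cong +_ (L-ud≡sum-reduced n m)) (+sumBelow≡sumTo (2 ℕ.* n) (λ ℓ → reduced ℓ n 0 m))

open FiniteDifferences using (δ; δ-cong; δ≡alternatingSum; alternatingSum; sumTo-cong; δ-top-sumTo; sign-even)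
open Walks using (walks; walks≡catalan)
open Paths using (reduced)
open PeakPolynomials using (polynomialCounts; L-ud≡sumTo-reduced)
open import Defs
open import Data.Nat using (ℕ; _+_; _*_)
open import Data.Nat.Combinatorics using (_C_)
open import Data.Integer using (ℤ; +_) renaming (_*_ to _ℤ*_)
open import Data.Integer.Properties using (pos-*; *-identityˡ)
open import Data.Nat.Solver using (module +-*-Solver)
open import Data.Product using (proj₁)
open import Relation.Binary.PropositionalEquality using (_≡_; refl; trans; cong; cong₂; module ≡-Reasoning)

theorem4p2 : (n m : ℕ) →
    sumTo (2 * n) (λ i → Data.Integer._*_ (sign i) (+ (((2 * n) C i) * L-ud (n + 2 * m + 2 * i) (m + i))))
    ≡ + catalan n
theorem4p2 n m = begin
    sumTo (2 * n) (λ i → sign i ℤ* + (((2 * n) C i) * L-ud (n + 2 * m + 2 * i) (m + i)))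
  ≡⟨ sumTo-cong (2 * n) term ⟩
    alternatingSum (2 * n) f m
  ≡⟨ δ≡alternatingSum (2 * n) f m ⟨
    δ (2 * n) f m
  ≡⟨ δ-cong (2 * n) (λ x → L-ud≡sumTo-reduced n x) m ⟩
    δ (2 * n) (λ x → sumTo (2 * n) (λ ℓ → + reduced ℓ n 0 x)) m
  ≡⟨ δ-top-sumTo (2 * n) (λ ℓ → proj₁ (polynomialCounts ℓ n 0)) m ⟩
    sign (2 * n) ℤ* + walks (2 * n) n 0
  ≡⟨ cong₂ _ℤ*_ (sign-even n) (cong +_ (walks≡catalan n)) ⟩
    + 1 ℤ* + catalan n
  ≡⟨ *-identityˡ (+ catalan n) ⟩
    + catalan n ∎
  where
  open ≡-Reasoning
  open +-*-Solver
  f : ℕ → ℤ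
  f x = + L-ud (n + 2 * x) x
  term : ∀ i → sign i ℤ* + (((2 * n) C i) * L-ud (n + 2 * m + 2 * i) (m + i)) ≡ sign i ℤ* (+ ((2 * n) C i) ℤ* f (m + i))
  term i = cong (sign i ℤ*_) (trans (pos-* ((2 * n) C i) _)
    (cong (λ N → + ((2 * n) C i) ℤ* + L-ud N (m + i)) (solve 3 (λ n m i → n :+ con 2 :* m :+ con 2 :* i := n :+ con 2 :* (m :+ i)) refl n m i)))
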